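{- Let $\mathcal M$ and $\mathcal M'$ be matroids without loops on the same ground set $E$ and of the same rank $r$, and let $\mathcal H$ and $\mathcal H'$ be their respective families of hyperplanes. If $\mathcal H\subseteq\mathcal H'$, then $\mathcal H=\mathcal H'$ and $\mathcal M=\mathcal M'$. -}

module Defs where

open import Data.Nat using (ℕ; suc; _≤_; _<_)
open import Data.Fin using (Fin)
open import Data.Fin.Subset using (Subset; ⊥; ⊤; ⁅_⁆; _∈_; _∉_; _⊆_; _∪_; ∣_∣)
open import Data.Product using (∃; _×_)
open import Relation.Nullary using (¬_)
open import Relation.Unary using (Decidable)
open import Relation.Binary.PropositionalEquality using (_≡_)

-- Independence is decidable (automatic classically for a
-- finite ground set; included so that the structure is usable constructively).
record Matroid (n : ℕ) : Set₁ where
  field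
    Indep     : Subset n → Set
    indep?    : Decidable Indep
    indep-⊥   : Indep ⊥
    indep-⊆   : ∀ {I J} → J ⊆ I → Indep I → Indep J
    indep-aug : ∀ {I J} → Indep I → Indep J → ∣ I ∣ < ∣ J ∣ →
                ∃ λ e → e ∈ J × e ∉ I × Indep (I ∪ ⁅ e ⁆)

open Matroid public

module _ {n : ℕ} (M : Matroid n) where

  HasRank : Subset n → ℕ → Set
  HasRank X k =
    (∃ λ I → I ⊆ X × Indep M I × ∣ I ∣ ≡ k) ×
    (∀ J → J ⊆ X → Indep M J → ∣ J ∣ ≤ k)

  Loopless : Set
  Loopless = ∀ (e : Fin n) → Indep M ⁅ e ⁆

  IsFlat : Subset n → Set
  IsFlat X = ∀ e → e ∉ X → ∀ k → HasRank X k → ¬ HasRank (X ∪ ⁅ e ⁆) k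

  -- X is a hyperplane: a flat of rank r(M) - 1
  -- (so a matroid of rank 0 has no hyperplanes).
  IsHyperplane : Subset n → Set
  IsHyperplane X = IsFlat X × ∃ λ k → HasRank ⊤ (suc k) × HasRank X k

-- An M-independent set X is M′-independent: otherwise take a maximal M′-independent
-- K ⊆ X and f ∈ X ∖ K.  Extending K ∪ {f} to an M-basis B, the M-closure of B - f is an
-- M-hyperplane, hence an M′-flat, containing K but not f; so K ∪ {f} is M′-independent,
-- contradicting maximality.  Conversely an M′-basis B is M-independent: otherwise a
-- maximal M-independent K ⊂ B has fewer than r elements and extends to an independent
-- set of size r - 1 whose M-closure is a hyperplane containing B; but as an
-- M′-hyperplane it has M′-rank r - 1 and cannot contain the r-element M′-independent B.
-- With the same independent sets, both matroids have the same hyperplanes.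
module Submission where

open import Defs
open import Data.Nat using (ℕ; zero; suc; _≤_; _<_; _+_; _∸_; z≤n; s≤s; _≤?_)
open import Data.Nat.Properties using (<⇒≱; m≤m+n; 1+n≰n; ≤-antisym; ≤-reflexive; <-irrefl; ≰⇒>; <-≤-trans; m+[n∸m]≡n; m<m+n; +-suc; +-identityʳ; n≤1+n)
open import Data.Fin using (Fin; zero; suc)
open import Data.Fin.Subset
open import Data.Fin.Subset.Properties
open import Data.Fin.Properties using (any?)
open import Data.Vec using (_∷_; tabulate; here; there)
open import Data.Vec.Properties using (lookup∘tabulate; lookup⇒[]=; []=⇒lookup)
open import Data.Product using (_×_; _,_; ∃; proj₁)
open import Data.Sum using (_⊎_; inj₁; inj₂)
open import Data.Empty using (⊥-elim)
open import Function using (_∘_)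
open import Function.Bundles using (_⇔_; mk⇔; Equivalence)
open import Function.Properties.Equivalence using () renaming (sym to ⇔-sym)
open import Relation.Nullary using (¬_; yes; no; does)
open import Relation.Nullary.Decidable using (_×-dec_; _⊎-dec_; ¬?; dec-true)
open import Relation.Unary using (Pred; Decidable)
open import Relation.Binary.PropositionalEquality using (_≡_; refl; sym; trans; cong; subst)

private
  variable
    n : ℕ
    x : Fin n
    p q : Subset n

x∉p⇒∣p∪⁅x⁆∣≡1+∣p∣ : x ∉ p → ∣ p ∪ ⁅ x ⁆ ∣ ≡ suc ∣ p ∣
x∉p⇒∣p∪⁅x⁆∣≡1+∣p∣ {x = zero}  {p = outside ∷ p} _   = cong (suc ∘ ∣_∣) (∪-identityʳ p)
x∉p⇒∣p∪⁅x⁆∣≡1+∣p∣ {x = zero}  {p = inside  ∷ p} x∉p = ⊥-elim (x∉p here)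
x∉p⇒∣p∪⁅x⁆∣≡1+∣p∣ {x = suc x} {p = outside ∷ p} x∉p = x∉p⇒∣p∪⁅x⁆∣≡1+∣p∣ (x∉p ∘ there)
x∉p⇒∣p∪⁅x⁆∣≡1+∣p∣ {x = suc x} {p = inside  ∷ p} x∉p = cong suc (x∉p⇒∣p∪⁅x⁆∣≡1+∣p∣ (x∉p ∘ there))

x∈p⇒1+∣p-x∣≡∣p∣ : x ∈ p → suc ∣ p - x ∣ ≡ ∣ p ∣
x∈p⇒1+∣p-x∣≡∣p∣ {x = zero}  {p = inside  ∷ p} here        = cong (suc ∘ ∣_∣) (p─⊥≡p p)
x∈p⇒1+∣p-x∣≡∣p∣ {x = suc x} {p = outside ∷ p} (there x∈p) = x∈p⇒1+∣p-x∣≡∣p∣ x∈p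
x∈p⇒1+∣p-x∣≡∣p∣ {x = suc x} {p = inside  ∷ p} (there x∈p) = cong suc (x∈p⇒1+∣p-x∣≡∣p∣ x∈p)

x∉p-x : x ∉ p - x
x∉p-x {x = suc x} {p = _ ∷ p} (there x∈p-x) = x∉p-x x∈p-x

x∈p∪⁅x⁆ : x ∈ p ∪ ⁅ x ⁆
x∈p∪⁅x⁆ {x = x} {p = p} = q⊆p∪q p ⁅ x ⁆ (x∈⁅x⁆ x)

p⊆q∧x∈q⇒p∪⁅x⁆⊆q : ∀ {p q : Subset n} {x} → p ⊆ q → x ∈ q → p ∪ ⁅ x ⁆ ⊆ q
p⊆q∧x∈q⇒p∪⁅x⁆⊆q {p = p} {q} {x} p⊆q x∈q y∈ with x∈p∪q⁻ p ⁅ x ⁆ y∈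
... | inj₁ y∈p  = p⊆q y∈p
... | inj₂ y∈⁅x⁆ = subst (_∈ q) (sym (x∈⁅y⁆⇒x≡y x y∈⁅x⁆)) x∈q

∪⁅⁆-mono : p ⊆ q → p ∪ ⁅ x ⁆ ⊆ q ∪ ⁅ x ⁆
∪⁅⁆-mono p⊆q = p⊆q∧x∈q⇒p∪⁅x⁆⊆q (p⊆p∪q _ ∘ p⊆q) x∈p∪⁅x⁆

⊆⊎∃∉ : (p q : Subset n) → p ⊆ q ⊎ ∃ λ x → x ∈ p × x ∉ q
⊆⊎∃∉ p q with any? (λ x → x ∈? p ×-dec ¬? (x ∈? q))
... | yes witness = inj₂ witness
... | no ¬witness = inj₁ λ {x} x∈p → decide x x∈p
  where
  decide : ∀ x → x ∈ p → x ∈ q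
  decide x x∈p with x ∈? q
  ... | yes x∈q = x∈q
  ... | no  x∉q = ⊥-elim (¬witness (x , x∈p , x∉q))

comprehension : ∀ {ℓ} {P : Pred (Fin n) ℓ} → Decidable P → Subset n
comprehension P? = tabulate (does ∘ P?)

module _ {ℓ} {P : Pred (Fin n) ℓ} (P? : Decidable P) where

  ∈-comprehension⁺ : P x → x ∈ comprehension P?
  ∈-comprehension⁺ {x = x} Px =
    lookup⇒[]= x _ (trans (lookup∘tabulate (does ∘ P?) x) (dec-true (P? x) Px))

  ∈-comprehension⁻ : x ∈ comprehension P? → P x
  ∈-comprehension⁻ {x = x} x∈
    with P? x | trans (sym (lookup∘tabulate (does ∘ P?) x)) ([]=⇒lookup x∈)
  ... | yes Px | _  = Px
  ... | no  _  | ()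

module MatroidProperties {n : ℕ} (N : Matroid n) where

  hasRank-unique : ∀ {X k k′} → HasRank N X k → HasRank N X k′ → k ≡ k′
  hasRank-unique ((I , I⊆X , indI , refl) , maxI) ((J , J⊆X , indJ , refl) , maxJ) =
    ≤-antisym (maxJ I I⊆X indI) (maxI J J⊆X indJ)

  isHyperplane⇒indep-size<rank : ∀ {r H J} → HasRank N ⊤ r → IsHyperplane N H →
                                 J ⊆ H → Indep N J → ∣ J ∣ < r
  isHyperplane⇒indep-size<rank {J = J} rank (_ , _ , rank′ , (_ , maxH)) J⊆H indJ =
    subst (∣ J ∣ <_) (hasRank-unique rank′ rank) (s≤s (maxH _ J⊆H indJ))

  augment : ∀ {I K t} → Indep N I → Indep N K → ∣ K ∣ ≤ t → t ≤ ∣ I ∣ →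
            ∃ λ K′ → K ⊆ K′ × Indep N K′ × ∣ K′ ∣ ≡ t
  augment {I} {K} {t} indI indK K≤t t≤I = grow (t ∸ ∣ K ∣) indK (m+[n∸m]≡n K≤t)
    where
    grow : ∀ d {K} → Indep N K → ∣ K ∣ + d ≡ t → ∃ λ K′ → K ⊆ K′ × Indep N K′ × ∣ K′ ∣ ≡ t
    grow zero    {K} indK size = K , ⊆-refl , indK , trans (sym (+-identityʳ _)) size
    grow (suc d) {K} indK size
      with indep-aug N indK indI (<-≤-trans (subst (∣ K ∣ <_) size (m<m+n ∣ K ∣ (s≤s z≤n))) t≤I)
    ... | g , _ , g∉K , indKg
      with grow d indKg (trans (cong (_+ d) (x∉p⇒∣p∪⁅x⁆∣≡1+∣p∣ g∉K)) (trans (sym (+-suc ∣ K ∣ d)) size))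
    ... | K′ , Kg⊆K′ , indK′ , size′ = K′ , Kg⊆K′ ∘ p⊆p∪q _ , indK′ , size′

  -- For independent K, Spans K is membership in the closure of K; a dependent K spans everything.
  Spans : Subset n → Pred (Fin n) _
  Spans K e = e ∈ K ⊎ ¬ Indep N (K ∪ ⁅ e ⁆)

  spans? : ∀ K → Decidable (Spans K)
  spans? K e = e ∈? K ⊎-dec ¬? (indep? N (K ∪ ⁅ e ⁆))

  closure : Subset n → Subset n
  closure K = comprehension (spans? K)

  p⊆closure : ∀ {K} → K ⊆ closure K
  p⊆closure {K} = ∈-comprehension⁺ (spans? K) ∘ inj₁

  dependent⇒∈closure : ∀ {K e} → ¬ Indep N (K ∪ ⁅ e ⁆) → e ∈ closure K
  dependent⇒∈closure {K} = ∈-comprehension⁺ (spans? K) ∘ inj₂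

  ∈closure∧∉⇒dependent : ∀ {K e} → e ∈ closure K → e ∉ K → ¬ Indep N (K ∪ ⁅ e ⁆)
  ∈closure∧∉⇒dependent {K} e∈ e∉K with ∈-comprehension⁻ (spans? K) e∈
  ... | inj₁ e∈K = ⊥-elim (e∉K e∈K)
  ... | inj₂ dep = dep

  ∉closure⇒indep : ∀ {K e} → e ∉ closure K → Indep N (K ∪ ⁅ e ⁆)
  ∉closure⇒indep {K} {e} e∉ with indep? N (K ∪ ⁅ e ⁆)
  ... | yes ind = ind
  ... | no  dep = ⊥-elim (e∉ (dependent⇒∈closure dep))

  closure-mono : ∀ {K K′} → K ⊆ K′ → closure K ⊆ closure K′
  closure-mono {K} K⊆K′ e∈ with ∈-comprehension⁻ (spans? K) e∈
  ... | inj₁ e∈K = p⊆closure (K⊆K′ e∈K)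
  ... | inj₂ dep = dependent⇒∈closure (dep ∘ indep-⊆ N (∪⁅⁆-mono K⊆K′))

  hasRank-spanned : ∀ {K Y} → Indep N K → K ⊆ Y → Y ⊆ closure K → HasRank N Y ∣ K ∣
  hasRank-spanned {K} {Y} indK K⊆Y Y⊆cl = (K , K⊆Y , indK , refl) , bound
    where
    bound : ∀ J → J ⊆ Y → Indep N J → ∣ J ∣ ≤ ∣ K ∣
    bound J J⊆Y indJ with ∣ J ∣ ≤? ∣ K ∣
    ... | yes J≤K = J≤K
    ... | no  J≰K with indep-aug N indK indJ (≰⇒> J≰K)
    ... | g , g∈J , g∉K , indKg = ⊥-elim (∈closure∧∉⇒dependent (Y⊆cl (J⊆Y g∈J)) g∉K indKg)

  closure-isFlat : ∀ {K} → Indep N K → IsFlat N (closure K)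
  closure-isFlat {K} indK e e∉ k rank (_ , bound)
    with hasRank-unique rank (hasRank-spanned indK p⊆closure ⊆-refl)
  ... | refl = 1+n≰n (subst (_≤ ∣ K ∣) (x∉p⇒∣p∪⁅x⁆∣≡1+∣p∣ (e∉ ∘ p⊆closure))
                        (bound _ (∪⁅⁆-mono p⊆closure) (∉closure⇒indep e∉)))

  closure-isHyperplane : ∀ {K} → Indep N K → HasRank N ⊤ (suc ∣ K ∣) → IsHyperplane N (closure K)
  closure-isHyperplane indK rank =
    closure-isFlat indK , _ , rank , hasRank-spanned indK p⊆closure ⊆-refl

  spans-or-extends : ∀ {K Y} → K ⊆ Y →
                     Y ⊆ closure K ⊎ ∃ λ f → f ∈ Y × f ∉ K × Indep N (K ∪ ⁅ f ⁆)
  spans-or-extends {K} {Y} K⊆Y with ⊆⊎∃∉ Y (closure K)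
  ... | inj₁ Y⊆cl               = inj₁ Y⊆cl
  ... | inj₂ (f , f∈Y , f∉cl) = inj₂ (f , f∈Y , f∉cl ∘ p⊆closure , ∉closure⇒indep f∉cl)

  spanning-extension : ∀ {K Y} → K ⊆ Y → Indep N K →
                       ∃ λ K′ → K ⊆ K′ × K′ ⊆ Y × Indep N K′ × Y ⊆ closure K′
  spanning-extension {K} {Y} K⊆Y indK = grow ∣ Y ∣ K⊆Y indK (m≤m+n ∣ Y ∣ ∣ K ∣)
    where
    grow : ∀ d {K} → K ⊆ Y → Indep N K → ∣ Y ∣ ≤ d + ∣ K ∣ →
           ∃ λ K′ → K ⊆ K′ × K′ ⊆ Y × Indep N K′ × Y ⊆ closure K′
    grow zero K⊆Y indK Y≤K with spans-or-extends K⊆Y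
    ... | inj₁ Y⊆cl                = _ , ⊆-refl , K⊆Y , indK , Y⊆cl
    ... | inj₂ (f , f∈Y , f∉K , _) = ⊥-elim (<⇒≱ (p⊂q⇒∣p∣<∣q∣ (K⊆Y , f , f∈Y , f∉K)) Y≤K)
    grow (suc d) {K} K⊆Y indK Y≤1+d+K with spans-or-extends K⊆Y
    ... | inj₁ Y⊆cl                    = K , ⊆-refl , K⊆Y , indK , Y⊆cl
    ... | inj₂ (f , f∈Y , f∉K , indKf)
      with grow d (p⊆q∧x∈q⇒p∪⁅x⁆⊆q K⊆Y f∈Y) indKf (subst (∣ Y ∣ ≤_) size Y≤1+d+K)
      where
      size : suc d + ∣ K ∣ ≡ d + ∣ K ∪ ⁅ f ⁆ ∣
      size = trans (sym (+-suc d ∣ K ∣)) (cong (d +_) (sym (x∉p⇒∣p∪⁅x⁆∣≡1+∣p∣ f∉K)))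
    ... | K′ , Kf⊆K′ , rest = K′ , Kf⊆K′ ∘ p⊆p∪q _ , rest

  spanning-subset : ∀ Y → ∃ λ K → K ⊆ Y × Indep N K × Y ⊆ closure K
  spanning-subset Y with spanning-extension {⊥} {Y} (⊥-elim ∘ ∉⊥) (indep-⊥ N)
  ... | K , _ , spanning = K , spanning

  -- f depends on a basis of F containing K, so adding f to F would not raise the rank.
  isFlat⇒indep-∪⁅⁆ : ∀ {F K f} → IsFlat N F → K ⊆ F → Indep N K → f ∉ F → Indep N (K ∪ ⁅ f ⁆)
  isFlat⇒indep-∪⁅⁆ {F} {K} {f} flat K⊆F indK f∉F with indep? N (K ∪ ⁅ f ⁆)
  ... | yes indKf = indKf
  ... | no  depKf with spanning-extension K⊆F indK
  ... | K′ , K⊆K′ , K′⊆F , indK′ , F⊆cl =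
    ⊥-elim (flat f f∉F ∣ K′ ∣ (hasRank-spanned indK′ K′⊆F F⊆cl)
                              (hasRank-spanned indK′ (p⊆p∪q _ ∘ K′⊆F) Ff⊆cl))
    where
    Ff⊆cl : F ∪ ⁅ f ⁆ ⊆ closure K′
    Ff⊆cl = p⊆q∧x∈q⇒p∪⁅x⁆⊆q F⊆cl (dependent⇒∈closure (depKf ∘ indep-⊆ N (∪⁅⁆-mono K⊆K′)))

  hyperplane-separating : ∀ {r K f} → HasRank N ⊤ r → f ∉ K → Indep N (K ∪ ⁅ f ⁆) →
                          ∃ λ H → IsHyperplane N H × K ⊆ H × f ∉ H
  hyperplane-separating {K = K} {f} rank@((I , _ , indI , |I|≡r) , maxI) f∉K indKf
    with augment indI indKf (maxI _ ⊆⊤ indKf) (≤-reflexive (sym |I|≡r))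
  ... | B , Kf⊆B , indB , |B|≡r =
    closure (B - f) , closure-isHyperplane indB-f rankB , p⊆closure ∘ K⊆B-f , f∉closure
    where
    f∈B : f ∈ B
    f∈B = Kf⊆B x∈p∪⁅x⁆
    indB-f : Indep N (B - f)
    indB-f = indep-⊆ N (p─q⊆p B ⁅ f ⁆) indB
    rankB : HasRank N ⊤ (suc ∣ B - f ∣)
    rankB = subst (HasRank N ⊤) (sym (trans (x∈p⇒1+∣p-x∣≡∣p∣ f∈B) |B|≡r)) rank
    K⊆B-f : K ⊆ B - f
    K⊆B-f e∈K = x∈p∧x≢y⇒x∈p-y (Kf⊆B (p⊆p∪q _ e∈K)) (λ { refl → f∉K e∈K })
    f∉closure : f ∉ closure (B - f)
    f∉closure f∈ = ∈closure∧∉⇒dependent f∈ x∉p-x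
                     (indep-⊆ N (p⊆q∧x∈q⇒p∪⁅x⁆⊆q (p─q⊆p B ⁅ f ⁆) f∈B) indB)

  hyperplane-above : ∀ {r K} → HasRank N ⊤ r → Indep N K → ∣ K ∣ < r →
                     ∃ λ H → IsHyperplane N H × closure K ⊆ H
  hyperplane-above rank@((I , _ , indI , |I|≡r) , _) indK (s≤s K≤r-1)
    with augment indI indK K≤r-1 (subst (_ ≤_) (sym |I|≡r) (n≤1+n _))
  ... | K′ , K⊆K′ , indK′ , refl = closure K′ , closure-isHyperplane indK′ rank , closure-mono K⊆K′

hasRank-transfer : (M M′ : Matroid n) → (∀ X → Indep M X ⇔ Indep M′ X) →
                   ∀ {X k} → HasRank M X k → HasRank M′ X k
hasRank-transfer M M′ indep⇔ ((I , I⊆X , indI , size) , maxI) =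
  (I , I⊆X , Equivalence.to (indep⇔ I) indI , size) ,
  λ J J⊆X → maxI J J⊆X ∘ Equivalence.from (indep⇔ J)

isHyperplane-transfer : (M M′ : Matroid n) → (∀ X → Indep M X ⇔ Indep M′ X) →
                        ∀ {X} → IsHyperplane M X → IsHyperplane M′ X
isHyperplane-transfer M M′ indep⇔ (flat , k , rank⊤ , rankX) =
  (λ e e∉ k′ rank rank′ → flat e e∉ k′ (back rank) (back rank′)) ,
  k , hasRank-transfer M M′ indep⇔ rank⊤ , hasRank-transfer M M′ indep⇔ rankX
  where
  back : ∀ {Y k} → HasRank M′ Y k → HasRank M Y k
  back = hasRank-transfer M′ M (⇔-sym ∘ indep⇔)

module _ {n r : ℕ} (M M′ : Matroid n) (rank : HasRank M ⊤ r)
         (hyperplanes⊆ : ∀ X → IsHyperplane M X → IsHyperplane M′ X) where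

  private
    module M  = MatroidProperties M
    module M′ = MatroidProperties M′

  indep⇒indep′ : ∀ {X} → Indep M X → Indep M′ X
  indep⇒indep′ {X} indX with M′.spanning-subset X
  ... | K , K⊆X , indK , X⊆cl with ⊆⊎∃∉ X K
  ... | inj₁ X⊆K = indep-⊆ M′ X⊆K indK
  ... | inj₂ (f , f∈X , f∉K)
    with M.hyperplane-separating rank f∉K (indep-⊆ M (p⊆q∧x∈q⇒p∪⁅x⁆⊆q K⊆X f∈X) indX)
  ... | H , isH , K⊆H , f∉H =
    ⊥-elim (M′.∈closure∧∉⇒dependent (X⊆cl f∈X) f∉K
             (M′.isFlat⇒indep-∪⁅⁆ (proj₁ (hyperplanes⊆ H isH)) K⊆H indK f∉H))

  basis′⇒indep : ∀ {B} → HasRank M′ ⊤ r → Indep M′ B → ∣ B ∣ ≡ r → Indep M B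
  basis′⇒indep {B} rank′ indB |B|≡r with M.spanning-subset B
  ... | K , K⊆B , indK , B⊆cl with ⊆⊎∃∉ B K
  ... | inj₁ B⊆K = indep-⊆ M B⊆K indK
  ... | inj₂ (f , f∈B , f∉K)
    with M.hyperplane-above rank indK (subst (∣ K ∣ <_) |B|≡r (p⊂q⇒∣p∣<∣q∣ (K⊆B , f , f∈B , f∉K)))
  ... | H , isH , clK⊆H =
    ⊥-elim (<-irrefl |B|≡r (M′.isHyperplane⇒indep-size<rank rank′ (hyperplanes⊆ H isH) (clK⊆H ∘ B⊆cl) indB))

  indep′⇒indep : ∀ {X} → HasRank M′ ⊤ r → Indep M′ X → Indep M X
  indep′⇒indep {X} rank′@((I , _ , indI , |I|≡r) , max′) indX
    with M′.augment indI indX (max′ X ⊆⊤ indX) (≤-reflexive (sym |I|≡r))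
  ... | B , X⊆B , indB , |B|≡r = indep-⊆ M X⊆B (basis′⇒indep rank′ indB |B|≡r)

proposition3p2 : (n : ℕ) (M M′ : Matroid n) (r : ℕ) →
    Loopless M → Loopless M′ →
    HasRank M ⊤ r → HasRank M′ ⊤ r →
    (∀ (X : Subset n) → IsHyperplane M X → IsHyperplane M′ X) →
    (∀ (X : Subset n) → IsHyperplane M X ⇔ IsHyperplane M′ X) ×
    (∀ (X : Subset n) → Indep M X ⇔ Indep M′ X)
proposition3p2 n M M′ r _ _ rank rank′ hyperplanes⊆ =
  (λ X → mk⇔ (hyperplanes⊆ X) (isHyperplane-transfer M′ M (⇔-sym ∘ indep⇔))) , indep⇔
  where
  indep⇔ : ∀ X → Indep M X ⇔ Indep M′ X
  indep⇔ X = mk⇔ (indep⇒indep′ M M′ rank hyperplanes⊆) (indep′⇒indep M M′ rank hyperplanes⊆ rank′)
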